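{- On the set of formulas of LEL, the relation $\phi\equiv\psi$ iff $\vdash\phi\leftrightarrow\psi$ is a congruence: it is an equivalence relation, and $\phi\equiv\psi$ implies $\neg\phi\equiv\neg\psi$, and $\phi\equiv\psi$, $\chi\equiv\theta$ imply $\phi\mathbin{\dot\wedge}\chi\equiv\psi\mathbin{\dot\wedge}\theta$ and $\chi\mathbin{\dot\wedge}\phi\equiv\theta\mathbin{\dot\wedge}\psi$.
   Context: Let $P$ be a set of atomic propositions. Formulas of LEL are given by $\phi::= p\mid\bot\mid\phi\rightarrow\phi$ with $p\in P$. Abbreviations: $\neg\phi:=\phi\rightarrow\bot$; $\top:=\neg\bot$; $\phi\mathbin{\dot\wedge}\psi:=\neg(\phi\rightarrow\neg\psi)$; $\phi\wedge\psi:=\phi\mathbin{\dot\wedge}(\phi\rightarrow\psi)$. "$\vdash\phi\leftrightarrow\psi$" abbreviates "$\vdash\phi\rightarrow\psi$ and $\vdash\psi\rightarrow\phi$". The provable formulas ($\vdash\phi$) form the least set containing all instances of the axiom schemata and closed under the rules below (rules with "iff" apply in both directions): Axioms: (A1) $\vdash\phi\rightarrow\phi$; (A2) $\vdash\phi\leftrightarrow\neg\neg\phi$; (A3) $\vdash\phi\rightarrow\top$; (A4) $\vdash\phi\wedge\psi\rightarrow\phi$; (A5) $\vdash\phi\wedge\psi\rightarrow\psi$. Rules: (R1) $\vdash\phi$ iff $\vdash\top\rightarrow\phi$; (R2) $\vdash\phi\rightarrow\psi$ and $\vdash\psi\rightarrow\chi$ imply $\vdash\phi\rightarrow\chi$;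 (R3) $\vdash\phi\rightarrow\psi$ implies $\vdash\neg\psi\rightarrow\neg\phi$; (R4) $\vdash\phi\rightarrow\psi$ implies $\vdash(\neg\phi\rightarrow\psi)\leftrightarrow(\neg\psi\rightarrow\phi)$; (R5) $\vdash\phi\rightarrow\psi$ implies $\vdash\phi\rightarrow(\neg\phi\rightarrow\psi)$; (R6) $\vdash\phi\rightarrow\psi$ implies $\vdash\chi\mathbin{\dot\wedge}\phi\rightarrow\chi\mathbin{\dot\wedge}\psi$; (R7) $\vdash\phi\leftrightarrow\psi$ implies $\vdash\phi\mathbin{\dot\wedge}\chi\leftrightarrow\psi\mathbin{\dot\wedge}\chi$; (R8) $\vdash\phi\rightarrow\psi$ and $\vdash\phi\rightarrow\chi$ imply $\vdash\phi\rightarrow\psi\wedge\chi$; (R9) $\vdash\phi\rightarrow\neg\psi$, $\vdash\phi\rightarrow\neg\chi$ and $\vdash(\neg\phi\rightarrow\psi)\rightarrow\neg\chi$ imply $\vdash(\neg\phi\rightarrow\chi)\rightarrow\neg\psi$; (R10) $\vdash\neg\psi\rightarrow\chi$ and $\vdash\neg\phi\rightarrow\psi\mathbin{\dot\wedge}\chi$ imply $\vdash\phi\mathbin{\dot\wedge}(\psi\mathbin{\dot\wedge}\chi)\leftrightarrow(\phi\mathbin{\dot\wedge}\psi)\mathbin{\dot\wedge}\chi$. -}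

module Defs where

open import Level using (Level)
open import Data.Product using (_×_)

data Form {a : Level} (P : Set a) : Set a where
  atom : P → Form P
  ⊥'   : Form P
  _⇒_  : Form P → Form P → Form P

infixr 5 _⇒_

module _ {a : Level} {P : Set a} where

  ¬'_ : Form P → Form P
  ¬' φ = φ ⇒ ⊥'

  ⊤' : Form P
  ⊤' = ¬' ⊥'

  _∧̇_ : Form P → Form P → Form P
  φ ∧̇ ψ = ¬' (φ ⇒ ¬' ψ)

  _∧'_ : Form P → Form P → Form P
  φ ∧' ψ = φ ∧̇ (φ ⇒ ψ)

  -- Provability: least set containing axioms and closed under rules.
  -- "⊢ φ ↔ ψ" is an abbreviation for ⊢ φ → ψ and ⊢ ψ → φ; rules with
  -- "iff" are given one constructor per direction.
  data ⊢_ : Form P → Set a where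
    A1  : ∀ φ → ⊢ (φ ⇒ φ)
    A2a : ∀ φ → ⊢ (φ ⇒ ¬' ¬' φ)
    A2b : ∀ φ → ⊢ (¬' ¬' φ ⇒ φ)
    A3  : ∀ φ → ⊢ (φ ⇒ ⊤')
    A4  : ∀ φ ψ → ⊢ (φ ∧' ψ ⇒ φ)
    A5  : ∀ φ ψ → ⊢ (φ ∧' ψ ⇒ ψ)
    R1a : ∀ {φ} → ⊢ φ → ⊢ (⊤' ⇒ φ)
    R1b : ∀ {φ} → ⊢ (⊤' ⇒ φ) → ⊢ φ
    R2  : ∀ {φ ψ χ} → ⊢ (φ ⇒ ψ) → ⊢ (ψ ⇒ χ) → ⊢ (φ ⇒ χ)
    R3  : ∀ {φ ψ} → ⊢ (φ ⇒ ψ) → ⊢ (¬' ψ ⇒ ¬' φ)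
    R4a : ∀ {φ ψ} → ⊢ (φ ⇒ ψ) → ⊢ ((¬' φ ⇒ ψ) ⇒ (¬' ψ ⇒ φ))
    R4b : ∀ {φ ψ} → ⊢ (φ ⇒ ψ) → ⊢ ((¬' ψ ⇒ φ) ⇒ (¬' φ ⇒ ψ))
    R5  : ∀ {φ ψ} → ⊢ (φ ⇒ ψ) → ⊢ (φ ⇒ (¬' φ ⇒ ψ))
    R6  : ∀ {φ ψ} χ → ⊢ (φ ⇒ ψ) → ⊢ (χ ∧̇ φ ⇒ χ ∧̇ ψ)
    R7a : ∀ {φ ψ} χ → ⊢ (φ ⇒ ψ) → ⊢ (ψ ⇒ φ) → ⊢ (φ ∧̇ χ ⇒ ψ ∧̇ χ)
    R7b : ∀ {φ ψ} χ → ⊢ (φ ⇒ ψ) → ⊢ (ψ ⇒ φ) → ⊢ (ψ ∧̇ χ ⇒ φ ∧̇ χ)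
    R8  : ∀ {φ ψ χ} → ⊢ (φ ⇒ ψ) → ⊢ (φ ⇒ χ) → ⊢ (φ ⇒ ψ ∧' χ)
    R9  : ∀ {φ ψ χ} → ⊢ (φ ⇒ ¬' ψ) → ⊢ (φ ⇒ ¬' χ) → ⊢ ((¬' φ ⇒ ψ) ⇒ ¬' χ)
        → ⊢ ((¬' φ ⇒ χ) ⇒ ¬' ψ)
    R10a : ∀ {φ ψ χ} → ⊢ (¬' ψ ⇒ χ) → ⊢ (¬' φ ⇒ ψ ∧̇ χ)
         → ⊢ (φ ∧̇ (ψ ∧̇ χ) ⇒ (φ ∧̇ ψ) ∧̇ χ)
    R10b : ∀ {φ ψ χ} → ⊢ (¬' ψ ⇒ χ) → ⊢ (¬' φ ⇒ ψ ∧̇ χ)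
         → ⊢ ((φ ∧̇ ψ) ∧̇ χ ⇒ φ ∧̇ (ψ ∧̇ χ))

  infix 2 ⊢_

  _≡L_ : Form P → Form P → Set a
  φ ≡L ψ = (⊢ (φ ⇒ ψ)) × (⊢ (ψ ⇒ φ))

  infix 4 _≡L_

module Submission where

-- Everything follows directly from the rules of the calculus:
--   * reflexivity is axiom A1, symmetry swaps the two implications, and
--     transitivity composes implications in each direction with R2;
--   * negation respects ≡L by contraposition R3, applied in both directions;
--   * dotted conjunction respects ≡L in its right argument by R6 and in its
--     left argument by R7 (which needs the full equivalence as premise);
--     congruence in both arguments at once is obtained by first replacing
--     the left argument and then the right one, gluing the steps with
--     transitivity of ≡L.

open import Defs
open import Level using (Level)
open import Data.Product using (_×_; _,_)
open import Relation.Binary.Structures using (IsEquivalence)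

module _ {a : Level} {P : Set a} where

  ≡L-isEquivalence : IsEquivalence (_≡L_ {P = P})
  ≡L-isEquivalence = record
    { refl  = λ {φ} → A1 φ , A1 φ
    ; sym   = λ { (φ⇒ψ , ψ⇒φ) → ψ⇒φ , φ⇒ψ }
    ; trans = λ { (φ⇒ψ , ψ⇒φ) (ψ⇒χ , χ⇒ψ) → R2 φ⇒ψ ψ⇒χ , R2 χ⇒ψ ψ⇒φ }
    }

  open IsEquivalence ≡L-isEquivalence using () renaming (trans to ≡L-trans)

  ¬'-cong : ∀ {φ ψ : Form P} → φ ≡L ψ → ¬' φ ≡L ¬' ψ
  ¬'-cong (φ⇒ψ , ψ⇒φ) = R3 ψ⇒φ , R3 φ⇒ψ

  ∧̇-congˡ : ∀ (χ : Form P) {φ ψ : Form P} → φ ≡L ψ → χ ∧̇ φ ≡L χ ∧̇ ψ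
  ∧̇-congˡ χ (φ⇒ψ , ψ⇒φ) = R6 χ φ⇒ψ , R6 χ ψ⇒φ

  ∧̇-congʳ : ∀ (χ : Form P) {φ ψ : Form P} → φ ≡L ψ → φ ∧̇ χ ≡L ψ ∧̇ χ
  ∧̇-congʳ χ (φ⇒ψ , ψ⇒φ) = R7a χ φ⇒ψ ψ⇒φ , R7b χ φ⇒ψ ψ⇒φ

  ∧̇-cong : ∀ {φ ψ χ θ : Form P} → φ ≡L ψ → χ ≡L θ → φ ∧̇ χ ≡L ψ ∧̇ θ
  ∧̇-cong {ψ = ψ} {χ = χ} φ≡ψ χ≡θ = ≡L-trans (∧̇-congʳ χ φ≡ψ) (∧̇-congˡ ψ χ≡θ)

mainTheorem8 : {a : Level} {P : Set a} →
    IsEquivalence (_≡L_ {P = P})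
    × (∀ {φ ψ : Form P} → φ ≡L ψ → (¬' φ) ≡L (¬' ψ))
    × (∀ {φ ψ χ θ : Form P} → φ ≡L ψ → χ ≡L θ →
         ((φ ∧̇ χ) ≡L (ψ ∧̇ θ)) × ((χ ∧̇ φ) ≡L (θ ∧̇ ψ)))
mainTheorem8 =
    ≡L-isEquivalence
  , ¬'-cong
  , λ φ≡ψ χ≡θ → ∧̇-cong φ≡ψ χ≡θ , ∧̇-cong χ≡θ φ≡ψ
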